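{- Let $r,s$ be real numbers with $r\notin\{0,2\}$, $s\neq 0$ and $r^2+4s\ge 0$. Let $(h_n)$ be defined by $h_0=0$, $h_1=1$, $h_{n}=rh_{n-1}+sh_{n-2}$ for $n\ge 2$, with the convention $h_{ -1}=1/s$. Let $$\mathbf{A}_{h}=\frac{1}{r-2} \begin{bmatrix} r(r-1)+s& r+s &r^{2}+2s \\ -s&-s&-2s\\ 1-r&-1&-r \end{bmatrix}.$$ Then for every integer $n\ge1$, $$\mathbf{A}_{h}^{n}=\frac{1}{r-2}\begin{bmatrix} h_{n+2}-h_{n+1}&h_{n+1}+sh_{n}&h_{n+2}+sh_{n} \\ -s(h_{n}-h_{n-1})&-s(h_{n-1}+sh_{n-2})&-s(h_{n}+sh_{n-2})\\ -(h_{n+1}-h_{n})&-(h_{n}+sh_{n-1})&-(h_{n+1}+sh_{n-1}) \end{bmatrix}.$$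
   Context: The generalized Fibonacci numbers $h_n$ depend on the real parameters $r,s$ and satisfy $h_0=0$, $h_1=1$, $h_n=rh_{n-1}+sh_{n-2}$ ($n\ge2$); the value $h_{ -1}$ is defined to be $1/s$. -}

module Defs where

open import Level using (Level; _⊔_) renaming (suc to lsuc)
open import Algebra.Bundles using (CommutativeRing)
open import Relation.Binary.Structures using (IsTotalOrder)
open import Relation.Nullary using (¬_)
open import Data.Nat using (ℕ; zero; suc)
open import Data.Fin using (Fin) renaming (zero to f0; suc to fs)
open import Data.Product using (Σ; _×_)

-- An axiomatisation of the real numbers: a complete ordered field
-- (Dedekind-complete: every inhabited predicate bounded above has a least
-- upper bound).  Up to isomorphism the only model is ℝ.
-- Inverse is a total function; only x ≉ 0 ⇒ x * x⁻¹ ≈ 1 is assumed.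
record RealNumbers (c ℓ : Level) : Set (lsuc (c ⊔ ℓ)) where
  field
    commutativeRing : CommutativeRing c ℓ
  open CommutativeRing commutativeRing public hiding (zero)
  infix 4 _≤_
  infix 8 _⁻¹
  field
    _≤_          : Carrier → Carrier → Set ℓ
    isTotalOrder : IsTotalOrder _≈_ _≤_
    +-mono-≤     : ∀ {x y} z → x ≤ y → x + z ≤ y + z
    *-nonneg     : ∀ {x y} → 0# ≤ x → 0# ≤ y → 0# ≤ x * y
    0≉1          : ¬ (0# ≈ 1#)
    _⁻¹          : Carrier → Carrier
    ⁻¹-inverse   : ∀ x → ¬ (x ≈ 0#) → x * x ⁻¹ ≈ 1#
    complete     : (P : Carrier → Set (c ⊔ ℓ)) →
                   Σ Carrier P →
                   Σ Carrier (λ b → ∀ x → P x → x ≤ b) →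
                   Σ Carrier (λ u → (∀ x → P x → x ≤ u) ×
                                    (∀ b → (∀ x → P x → x ≤ b) → u ≤ b))

  2# : Carrier
  2# = 1# + 1#

  4# : Carrier
  4# = 2# + 2#

  Mat : Set c
  Mat = Fin 3 → Fin 3 → Carrier

  mat3 : (a b c' d e f g h i : Carrier) → Mat
  mat3 a b c' d e f g h i f0 f0 = a
  mat3 a b c' d e f g h i f0 (fs f0) = b
  mat3 a b c' d e f g h i f0 (fs (fs f0)) = c'
  mat3 a b c' d e f g h i (fs f0) f0 = d
  mat3 a b c' d e f g h i (fs f0) (fs f0) = e
  mat3 a b c' d e f g h i (fs f0) (fs (fs f0)) = f
  mat3 a b c' d e f g h i (fs (fs f0)) f0 = g
  mat3 a b c' d e f g h i (fs (fs f0)) (fs f0) = h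
  mat3 a b c' d e f g h i (fs (fs f0)) (fs (fs f0)) = i

  _⊗_ : Mat → Mat → Mat
  (A ⊗ B) i j = A i f0 * B f0 j + A i (fs f0) * B (fs f0) j
                + A i (fs (fs f0)) * B (fs (fs f0)) j

  idMat : Mat
  idMat i j = mat3 1# 0# 0# 0# 1# 0# 0# 0# 1# i j

  _^ᴹ_ : Mat → ℕ → Mat
  A ^ᴹ zero = idMat
  A ^ᴹ suc n = A ⊗ (A ^ᴹ n)

  scale : Carrier → Mat → Mat
  scale k A i j = k * A i j

  _≈ᴹ_ : Mat → Mat → Set ℓ
  A ≈ᴹ B = ∀ i j → A i j ≈ B i j

  h : Carrier → Carrier → ℕ → Carrier
  h r s zero = 0#
  h r s (suc zero) = 1#
  h r s (suc (suc n)) = r * h r s (suc n) + s * h r s n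

  -- hShift r s k = h_{k-1}, with the convention h_{-1} = 1/s
  hShift : Carrier → Carrier → ℕ → Carrier
  hShift r s zero = s ⁻¹
  hShift r s (suc k) = h r s k

  A-h : Carrier → Carrier → Mat
  A-h r s = scale ((r - 2#) ⁻¹)
    (mat3 (r * (r - 1#) + s) (r + s) (r * r + 2# * s)
          (- s) (- s) (- (2# * s))
          (1# - r) (- 1#) (- r))

module Submission where

-- Write A_h = (r - 2)⁻¹ · M with M the integer matrix of the paper, and for
-- two consecutive terms a = h_m, b = h_{m+1} let F(a, b) be the bracketed
-- matrix of the theorem, with h_{m+2} = rb + sa, h_{m+3} = r h_{m+2} + sb and
-- s·h_{m-1} replaced by b - ra.  Two polynomial identities drive the proof:
--   M · I = F(0, 1)   and   M · F(a, b) = (r - 2) · F(b, rb + sa),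
-- valid in every commutative ring.  Hence, with k = (r - 2)⁻¹,
--   A_h^{m+1} = k · F(h_m, h_{m+1})
-- by induction on m, since (kM)(kF) = k·k·(r - 2)·F' = k·F'.  Finally
-- F(h_m, h_{m+1}) is the matrix of the theorem because s·h_{m-1} = h_{m+1} - r h_m
-- (for m = 0 this uses h_{-1} = 1/s).

open import Defs
open import Level using (0ℓ)
open import Relation.Nullary using (¬_; yes; no)
open import Data.Nat using (ℕ; suc; zero)
import Data.Nat as ℕ
open import Data.Fin using (Fin) renaming (zero to f0; suc to fs)
open import Data.Maybe using (Maybe; just; nothing)
open import Data.Product using (_×_; _,_)
open import Data.Vec using (Vec; []; _∷_)
open import Relation.Binary.PropositionalEquality using (_≡_; cong)
open import Relation.Binary.Bundles using (Setoid)
import Relation.Binary.Reasoning.Setoid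
open import Algebra.Bundles using (CommutativeRing)
open import Algebra.Bundles.Raw using (RawRing)
open import Algebra.Solver.Ring.AlmostCommutativeRing
  using (fromCommutativeRing; _-Raw-AlmostCommutative⟶_)

-- An integer is represented by a pair (a , b) of
-- naturals standing for a − b; its interpretation first cancels common
-- successors, so that equal normal forms interpret to identical terms.
module IntegerCoefficientSolver {c ℓ} (R : CommutativeRing c ℓ) where
  open CommutativeRing R
  open import Algebra.Properties.Ring ring using (-0#≈0#; x[y-z]≈xy-xz; [y-z]x≈yx-zx)
  open import Algebra.Properties.AbelianGroup +-abelianGroup
    using (⁻¹-∙-comm; ⁻¹-anti-homo‿-)
  open import Algebra.Properties.CommutativeSemigroup +-commutativeSemigroup
    using (interchange)
  open import Algebra.Properties.Semiring.Mult.TCOptimised semiring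
    using (×-homo-+; ×1-homo-*) renaming (_×_ to _times_)
  open import Relation.Binary.Reasoning.Setoid setoid

  difference-+ : ∀ p q t u → (p - q) + (t - u) ≈ (p + t) - (q + u)
  difference-+ p q t u = begin
    (p - q) + (t - u)     ≈⟨ interchange p (- q) t (- u) ⟩
    (p + t) + (- q + - u) ≈⟨ +-congˡ (⁻¹-∙-comm q u) ⟩
    (p + t) - (q + u)     ∎

  difference-* : ∀ p q t u → (p - q) * (t - u) ≈ (p * t + q * u) - (p * u + q * t)
  difference-* p q t u = begin
    (p - q) * (t - u)                 ≈⟨ [y-z]x≈yx-zx (t - u) p q ⟩
    p * (t - u) - q * (t - u)         ≈⟨ +-cong (x[y-z]≈xy-xz p t u)
                                                (-‿cong (x[y-z]≈xy-xz q t u)) ⟩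
    (p * t - p * u) - (q * t - q * u) ≈⟨ +-congˡ (⁻¹-anti-homo‿- (q * t) (q * u)) ⟩
    (p * t - p * u) + (q * u - q * t) ≈⟨ difference-+ _ _ _ _ ⟩
    (p * t + q * u) - (p * u + q * t) ∎

  difference-pad : ∀ x p q → p - q ≈ (x + p) - (x + q)
  difference-pad x p q = begin
    p - q             ≈⟨ +-identityˡ (p - q) ⟨
    0# + (p - q)      ≈⟨ +-congʳ (-‿inverseʳ x) ⟨
    (x - x) + (p - q) ≈⟨ difference-+ x x p q ⟩
    (x + p) - (x + q) ∎

  difference-cancel : ∀ {p q t u} → u + p ≈ q + t → p - q ≈ t - u
  difference-cancel {p} {q} {t} {u} eq = begin
    p - q             ≈⟨ difference-pad u p q ⟩
    (u + p) - (u + q) ≈⟨ +-cong eq (-‿cong (+-comm u q)) ⟩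
    (q + t) - (q + u) ≈⟨ difference-pad q t u ⟨
    t - u             ∎

  fromℕ : ℕ → Carrier
  fromℕ n = n times 1#

  fromℕ-suc : ∀ n → fromℕ (suc n) ≈ 1# + fromℕ n
  fromℕ-suc n = ×-homo-+ 1# 1 n

  Differences : RawRing 0ℓ 0ℓ
  Differences = record
    { Carrier = ℕ × ℕ
    ; _≈_     = _≡_
    ; _+_     = λ { (a , b) (c , d) → (a ℕ.+ c , b ℕ.+ d) }
    ; _*_     = λ { (a , b) (c , d) → (a ℕ.* c ℕ.+ b ℕ.* d , a ℕ.* d ℕ.+ b ℕ.* c) }
    ; -_      = λ { (a , b) → (b , a) }
    ; 0#      = (0 , 0)
    ; 1#      = (1 , 0)
    }

  ⟦_⟧ℤ : ℕ × ℕ → Carrier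
  ⟦ a     , zero  ⟧ℤ = fromℕ a
  ⟦ zero  , suc b ⟧ℤ = - fromℕ (suc b)
  ⟦ suc a , suc b ⟧ℤ = ⟦ a , b ⟧ℤ

  ⟦⟧ℤ-difference : ∀ a b → ⟦ a , b ⟧ℤ ≈ fromℕ a - fromℕ b
  ⟦⟧ℤ-difference a       zero    = sym (trans (+-congˡ -0#≈0#) (+-identityʳ _))
  ⟦⟧ℤ-difference zero    (suc b) = sym (+-identityˡ _)
  ⟦⟧ℤ-difference (suc a) (suc b) = begin
    ⟦ a , b ⟧ℤ                                ≈⟨ ⟦⟧ℤ-difference a b ⟩
    fromℕ a - fromℕ b                         ≈⟨ difference-pad 1# _ _ ⟩
    (1# + fromℕ a) - (1# + fromℕ b)           ≈⟨ +-cong (fromℕ-suc a) (-‿cong (fromℕ-suc b)) ⟨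
    fromℕ (suc a) - fromℕ (suc b)             ∎

  ⟦⟧ℤ-+ : ∀ a b c d → ⟦ a ℕ.+ c , b ℕ.+ d ⟧ℤ ≈ ⟦ a , b ⟧ℤ + ⟦ c , d ⟧ℤ
  ⟦⟧ℤ-+ a b c d = begin
    ⟦ a ℕ.+ c , b ℕ.+ d ⟧ℤ                   ≈⟨ ⟦⟧ℤ-difference (a ℕ.+ c) (b ℕ.+ d) ⟩
    fromℕ (a ℕ.+ c) - fromℕ (b ℕ.+ d)         ≈⟨ +-cong (×-homo-+ 1# a c) (-‿cong (×-homo-+ 1# b d)) ⟩
    (fromℕ a + fromℕ c) - (fromℕ b + fromℕ d) ≈⟨ difference-+ _ _ _ _ ⟨
    (fromℕ a - fromℕ b) + (fromℕ c - fromℕ d) ≈⟨ +-cong (⟦⟧ℤ-difference a b) (⟦⟧ℤ-difference c d) ⟨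
    ⟦ a , b ⟧ℤ + ⟦ c , d ⟧ℤ                   ∎

  ⟦⟧ℤ-* : ∀ a b c d →
          ⟦ a ℕ.* c ℕ.+ b ℕ.* d , a ℕ.* d ℕ.+ b ℕ.* c ⟧ℤ ≈ ⟦ a , b ⟧ℤ * ⟦ c , d ⟧ℤ
  ⟦⟧ℤ-* a b c d = begin
    ⟦ a ℕ.* c ℕ.+ b ℕ.* d , a ℕ.* d ℕ.+ b ℕ.* c ⟧ℤ
      ≈⟨ ⟦⟧ℤ-difference (a ℕ.* c ℕ.+ b ℕ.* d) (a ℕ.* d ℕ.+ b ℕ.* c) ⟩
    fromℕ (a ℕ.* c ℕ.+ b ℕ.* d) - fromℕ (a ℕ.* d ℕ.+ b ℕ.* c)
      ≈⟨ +-cong (fromℕ-sumProd a c b d) (-‿cong (fromℕ-sumProd a d b c)) ⟩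
    (A * C + B * D) - (A * D + B * C)
      ≈⟨ difference-* A B C D ⟨
    (A - B) * (C - D)
      ≈⟨ *-cong (⟦⟧ℤ-difference a b) (⟦⟧ℤ-difference c d) ⟨
    ⟦ a , b ⟧ℤ * ⟦ c , d ⟧ℤ ∎
    where
    A B C D : Carrier
    A = fromℕ a
    B = fromℕ b
    C = fromℕ c
    D = fromℕ d
    fromℕ-sumProd : ∀ w x y z → fromℕ (w ℕ.* x ℕ.+ y ℕ.* z) ≈ fromℕ w * fromℕ x + fromℕ y * fromℕ z
    fromℕ-sumProd w x y z =
      trans (×-homo-+ 1# (w ℕ.* x) (y ℕ.* z)) (+-cong (×1-homo-* w x) (×1-homo-* y z))

  ⟦⟧ℤ-neg : ∀ a b → ⟦ b , a ⟧ℤ ≈ - ⟦ a , b ⟧ℤ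
  ⟦⟧ℤ-neg a b = begin
    ⟦ b , a ⟧ℤ            ≈⟨ ⟦⟧ℤ-difference b a ⟩
    fromℕ b - fromℕ a     ≈⟨ ⁻¹-anti-homo‿- (fromℕ a) (fromℕ b) ⟨
    - (fromℕ a - fromℕ b) ≈⟨ -‿cong (⟦⟧ℤ-difference a b) ⟨
    - ⟦ a , b ⟧ℤ          ∎

  interpretation : Differences -Raw-AlmostCommutative⟶ fromCommutativeRing R
  interpretation = record
    { ⟦_⟧    = ⟦_⟧ℤ
    ; +-homo = λ { (a , b) (c , d) → ⟦⟧ℤ-+ a b c d }
    ; *-homo = λ { (a , b) (c , d) → ⟦⟧ℤ-* a b c d }
    ; -‿homo = λ { (a , b) → ⟦⟧ℤ-neg a b }
    ; 0-homo = refl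
    ; 1-homo = refl
    }

  ⟦⟧ℤ-equal? : ∀ x y → Maybe (⟦ x ⟧ℤ ≈ ⟦ y ⟧ℤ)
  ⟦⟧ℤ-equal? (a , b) (c , d) with d ℕ.+ a ℕ.≟ b ℕ.+ c
  ... | no _   = nothing
  ... | yes eq = just (begin
    ⟦ a , b ⟧ℤ        ≈⟨ ⟦⟧ℤ-difference a b ⟩
    fromℕ a - fromℕ b ≈⟨ difference-cancel cross ⟩
    fromℕ c - fromℕ d ≈⟨ ⟦⟧ℤ-difference c d ⟨
    ⟦ c , d ⟧ℤ        ∎)
    where
    cross : fromℕ d + fromℕ a ≈ fromℕ b + fromℕ c
    cross = trans (sym (×-homo-+ 1# d a))
                  (trans (reflexive (cong fromℕ eq)) (×-homo-+ 1# b c))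

  open import Algebra.Solver.Ring Differences (fromCommutativeRing R) interpretation ⟦⟧ℤ-equal?
    public

  lit : ∀ {n} → ℕ → Polynomial n
  lit k = con (k , 0)

-- The 3×3 matrices of the theorem, written once over an arbitrary raw ring.
-- They are instantiated at the real numbers and at the solver's polynomial
-- syntax; evaluating the latter gives back the former entry by entry.
module Shapes {a ℓ} (R : RawRing a ℓ) where
  open RawRing R

  infixl 6 _-_
  _-_ : Carrier → Carrier → Carrier
  x - y = x + - y

  Matrix : Set a
  Matrix = Fin 3 → Fin 3 → Carrier

  matrix3 : (a b c d e f g h i : Carrier) → Matrix
  matrix3 a b c d e f g h i f0           f0           = a
  matrix3 a b c d e f g h i f0           (fs f0)      = b
  matrix3 a b c d e f g h i f0           (fs (fs f0)) = c
  matrix3 a b c d e f g h i (fs f0)      f0           = d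
  matrix3 a b c d e f g h i (fs f0)      (fs f0)      = e
  matrix3 a b c d e f g h i (fs f0)      (fs (fs f0)) = f
  matrix3 a b c d e f g h i (fs (fs f0)) f0           = g
  matrix3 a b c d e f g h i (fs (fs f0)) (fs f0)      = h
  matrix3 a b c d e f g h i (fs (fs f0)) (fs (fs f0)) = i

  infixl 7 _·_
  _·_ : Matrix → Matrix → Matrix
  (A · B) i j = A i f0 * B f0 j + A i (fs f0) * B (fs f0) j
                + A i (fs (fs f0)) * B (fs (fs f0)) j

  scaleBy : Carrier → Matrix → Matrix
  scaleBy k A i j = k * A i j

  identity : Matrix
  identity = matrix3 1# 0# 0# 0# 1# 0# 0# 0# 1#

  two : Carrier
  two = 1# + 1#

  coefficientMatrix : (r s : Carrier) → Matrix
  coefficientMatrix r s =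
    matrix3 (r * (r - 1#) + s) (r + s) (r * r + two * s)
            (- s) (- s) (- (two * s))
            (1# - r) (- 1#) (- r)

  -- F(a, b): the bracketed matrix of the theorem, in terms of a = h_m and
  -- b = h_{m+1}; here c = h_{m+2}, d = h_{m+3} and x stands for s·h_{m-1}.
  fibMatrix : (r s a b : Carrier) → Matrix
  fibMatrix r s a b =
    matrix3 (d - c) (c + s * b) (d + s * b)
            (- (s * (b - a))) (- (s * (a + x))) (- (s * (b + x)))
            (- (c - b)) (- (b + s * a)) (- (c + s * a))
    where
    c d x : Carrier
    c = r * b + s * a
    d = r * c + s * b
    x = b - r * a

entrywise : ∀ {p} {P : Fin 3 → Fin 3 → Set p} →
  P f0 f0           → P f0 (fs f0)           → P f0 (fs (fs f0))           →
  P (fs f0) f0      → P (fs f0) (fs f0)      → P (fs f0) (fs (fs f0))      →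
  P (fs (fs f0)) f0 → P (fs (fs f0)) (fs f0) → P (fs (fs f0)) (fs (fs f0)) →
  ∀ i j → P i j
entrywise p00 p01 p02 p10 p11 p12 p20 p21 p22 = λ where
  f0           f0           → p00
  f0           (fs f0)      → p01
  f0           (fs (fs f0)) → p02
  (fs f0)      f0           → p10
  (fs f0)      (fs f0)      → p11
  (fs f0)      (fs (fs f0)) → p12
  (fs (fs f0)) f0           → p20
  (fs (fs f0)) (fs f0)      → p21
  (fs (fs f0)) (fs (fs f0)) → p22

module RealMatrices {c ℓ} (ℝ : RealNumbers c ℓ) where
  open RealNumbers ℝ
  open IntegerCoefficientSolver commutativeRing
    using (Polynomial; var; lit; _:+_; _:*_; :-_; _:-_; ⟦_⟧; ⟦_⟧↓; prove; solve; _:=_)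

  Syntax : ℕ → RawRing 0ℓ 0ℓ
  Syntax n = record
    { Carrier = Polynomial n ; _≈_ = _≡_
    ; _+_ = _:+_ ; _*_ = _:*_ ; -_ = :-_ ; 0# = lit 0 ; 1# = lit 1 }

  module Real = Shapes rawRing

  ≈ᴹ-setoid : Setoid c ℓ
  ≈ᴹ-setoid = record
    { Carrier       = Mat
    ; _≈_           = _≈ᴹ_
    ; isEquivalence = record
      { refl  = λ i j → refl
      ; sym   = λ A≈B i j → sym (A≈B i j)
      ; trans = λ A≈B B≈C i j → trans (A≈B i j) (B≈C i j)
      }
    }

  module ≈ᴹ-Reasoning = Relation.Binary.Reasoning.Setoid ≈ᴹ-setoid

  ⊗-cong : ∀ {A A′ B B′} → A ≈ᴹ A′ → B ≈ᴹ B′ → (A ⊗ B) ≈ᴹ (A′ ⊗ B′)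
  ⊗-cong A≈A′ B≈B′ i j =
    +-cong (+-cong (*-cong (A≈A′ i f0) (B≈B′ f0 j))
                   (*-cong (A≈A′ i (fs f0)) (B≈B′ (fs f0) j)))
           (*-cong (A≈A′ i (fs (fs f0))) (B≈B′ (fs (fs f0)) j))

  scale-cong : ∀ k {A B} → A ≈ᴹ B → scale k A ≈ᴹ scale k B
  scale-cong k A≈B i j = *-congˡ (A≈B i j)

  scale-scale : ∀ a b A → scale a (scale b A) ≈ᴹ scale (a * b) A
  scale-scale a b A i j = sym (*-assoc a b (A i j))

  scaleˡ-⊗ : ∀ k A B → (scale k A ⊗ B) ≈ᴹ scale k (A ⊗ B)
  scaleˡ-⊗ k A B i j =
    solve 7 (λ k a b c x y z →
                (k :* a) :* x :+ (k :* b) :* y :+ (k :* c) :* z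
             := k :* (a :* x :+ b :* y :+ c :* z))
          refl k (A i f0) (A i (fs f0)) (A i (fs (fs f0)))
                 (B f0 j) (B (fs f0) j) (B (fs (fs f0)) j)

  scaleʳ-⊗ : ∀ k A B → (A ⊗ scale k B) ≈ᴹ scale k (A ⊗ B)
  scaleʳ-⊗ k A B i j =
    solve 7 (λ k a b c x y z →
                a :* (k :* x) :+ b :* (k :* y) :+ c :* (k :* z)
             := k :* (a :* x :+ b :* y :+ c :* z))
          refl k (A i f0) (A i (fs f0)) (A i (fs (fs f0)))
                 (B f0 j) (B (fs f0) j) (B (fs (fs f0)) j)

  scaled-step : ∀ {k c M N N′} → k * c ≈ 1# → (M ⊗ N) ≈ᴹ scale c N′ →
                (scale k M ⊗ scale k N) ≈ᴹ scale k N′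
  scaled-step {k} {c} {M} {N} {N′} kc≈1 MN≈cN′ = begin
    scale k M ⊗ scale k N          ≈⟨ scaleˡ-⊗ k M (scale k N) ⟩
    scale k (M ⊗ scale k N)        ≈⟨ scale-cong k (scaleʳ-⊗ k M N) ⟩
    scale k (scale k (M ⊗ N))      ≈⟨ scale-cong k (scale-cong k MN≈cN′) ⟩
    scale k (scale k (scale c N′)) ≈⟨ scale-cong k (scale-scale k c N′) ⟩
    scale k (scale (k * c) N′)     ≈⟨ scale-cong k (λ i j → trans (*-congʳ kc≈1) (*-identityˡ _)) ⟩
    scale k N′                     ∎
    where open ≈ᴹ-Reasoning

  coefficient-base : ∀ r s → (Real.coefficientMatrix r s ⊗ idMat) ≈ᴹ Real.fibMatrix r s 0# 1#
  coefficient-base r s = entrywise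
    (byRing f0 f0 refl)           (byRing f0 (fs f0) refl)           (byRing f0 (fs (fs f0)) refl)
    (byRing (fs f0) f0 refl)      (byRing (fs f0) (fs f0) refl)      (byRing (fs f0) (fs (fs f0)) refl)
    (byRing (fs (fs f0)) f0 refl) (byRing (fs (fs f0)) (fs f0) refl) (byRing (fs (fs f0)) (fs (fs f0)) refl)
    where
    open Shapes (Syntax 2) using (Matrix; _·_; identity; coefficientMatrix; fibMatrix)
    ρ : Vec Carrier 2
    ρ = r ∷ s ∷ []
    lhs rhs : Matrix
    lhs = coefficientMatrix (var f0) (var (fs f0)) · identity
    rhs = fibMatrix (var f0) (var (fs f0)) (lit 0) (lit 1)
    byRing : ∀ i j → ⟦ lhs i j ⟧↓ ρ ≈ ⟦ rhs i j ⟧↓ ρ → ⟦ lhs i j ⟧ ρ ≈ ⟦ rhs i j ⟧ ρ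
    byRing i j = prove ρ (lhs i j) (rhs i j)

  coefficient-step : ∀ r s a b →
    (Real.coefficientMatrix r s ⊗ Real.fibMatrix r s a b)
      ≈ᴹ scale (r - 2#) (Real.fibMatrix r s b (r * b + s * a))
  coefficient-step r s a b = entrywise
    (byRing f0 f0 refl)           (byRing f0 (fs f0) refl)           (byRing f0 (fs (fs f0)) refl)
    (byRing (fs f0) f0 refl)      (byRing (fs f0) (fs f0) refl)      (byRing (fs f0) (fs (fs f0)) refl)
    (byRing (fs (fs f0)) f0 refl) (byRing (fs (fs f0)) (fs f0) refl) (byRing (fs (fs f0)) (fs (fs f0)) refl)
    where
    open Shapes (Syntax 4)
      using (Matrix; _·_; two; scaleBy; coefficientMatrix; fibMatrix)
    ρ : Vec Carrier 4
    ρ = r ∷ s ∷ a ∷ b ∷ []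
    R S A B : Polynomial 4
    R = var f0
    S = var (fs f0)
    A = var (fs (fs f0))
    B = var (fs (fs (fs f0)))
    lhs rhs : Matrix
    lhs = coefficientMatrix R S · fibMatrix R S A B
    rhs = scaleBy (R :- two) (fibMatrix R S B (R :* B :+ S :* A))
    byRing : ∀ i j → ⟦ lhs i j ⟧↓ ρ ≈ ⟦ rhs i j ⟧↓ ρ → ⟦ lhs i j ⟧ ρ ≈ ⟦ rhs i j ⟧ ρ
    byRing i j = prove ρ (lhs i j) (rhs i j)

  A-h-scaled : ∀ r s → A-h r s ≈ᴹ scale ((r - 2#) ⁻¹) (Real.coefficientMatrix r s)
  A-h-scaled r s = entrywise refl refl refl refl refl refl refl refl refl

  hMatrix : (r s : Carrier) → ℕ → Mat
  hMatrix r s m =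
    mat3 (h r s (suc (suc (suc m))) - h r s (suc (suc m)))
         (h r s (suc (suc m)) + s * h r s (suc m))
         (h r s (suc (suc (suc m))) + s * h r s (suc m))
         (- (s * (h r s (suc m) - h r s m)))
         (- (s * (h r s m + s * hShift r s m)))
         (- (s * (h r s (suc m) + s * hShift r s m)))
         (- (h r s (suc (suc m)) - h r s (suc m)))
         (- (h r s (suc m) + s * h r s m))
         (- (h r s (suc (suc m)) + s * h r s m))

  -- s h_{m-1} = h_{m+1} - r h_m; for m = 0 this is the convention h_{-1} = 1/s.
  s-hShift : ∀ r s → ¬ (s ≈ 0#) → ∀ m → s * hShift r s m ≈ h r s (suc m) - r * h r s m
  s-hShift r s s≉0 zero    =
    trans (⁻¹-inverse s s≉0) (solve 1 (λ r → lit 1 := lit 1 :- r :* lit 0) refl r)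
  s-hShift r s s≉0 (suc m) =
    solve 4 (λ r s a b → s :* a := (r :* b :+ s :* a) :- r :* b)
          refl r s (h r s m) (h r s (suc m))

  fibMatrix-h : ∀ r s → ¬ (s ≈ 0#) → ∀ m →
                Real.fibMatrix r s (h r s m) (h r s (suc m)) ≈ᴹ hMatrix r s m
  fibMatrix-h r s s≉0 m =
    entrywise refl refl refl refl (shifted (h r s m)) (shifted (h r s (suc m))) refl refl refl
    where
    shifted : ∀ x → - (s * (x + (h r s (suc m) - r * h r s m))) ≈ - (s * (x + s * hShift r s m))
    shifted x = -‿cong (*-congˡ (+-congˡ (sym (s-hShift r s s≉0 m))))

  inverse-r-2 : ∀ r → ¬ (r ≈ 2#) → (r - 2#) ⁻¹ * (r - 2#) ≈ 1#
  inverse-r-2 r r≉2 = trans (*-comm _ _) (⁻¹-inverse (r - 2#) r-2≉0)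
    where
    r-2≉0 : ¬ (r - 2# ≈ 0#)
    r-2≉0 r-2≈0 = r≉2 (begin
      r               ≈⟨ solve 1 (λ r → r := (r :- two) :+ two) refl r ⟩
      (r - 2#) + 2#   ≈⟨ +-congʳ r-2≈0 ⟩
      0# + 2#         ≈⟨ +-identityˡ 2# ⟩
      2#              ∎)
      where
      open Relation.Binary.Reasoning.Setoid setoid
      two : Polynomial 1
      two = lit 1 :+ lit 1

  powers : ∀ r s → ¬ (r ≈ 2#) → ∀ m →
           (A-h r s ^ᴹ suc m) ≈ᴹ scale ((r - 2#) ⁻¹) (Real.fibMatrix r s (h r s m) (h r s (suc m)))
  powers r s r≉2 zero = begin
    A-h r s ⊗ idMat                     ≈⟨ ⊗-cong {B = idMat} {B′ = idMat} (A-h-scaled r s) (λ i j → refl) ⟩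
    scale k M ⊗ idMat                   ≈⟨ scaleˡ-⊗ k M idMat ⟩
    scale k (M ⊗ idMat)                 ≈⟨ scale-cong k (coefficient-base r s) ⟩
    scale k (Real.fibMatrix r s 0# 1#)  ∎
    where
    open ≈ᴹ-Reasoning
    k : Carrier
    k = (r - 2#) ⁻¹
    M : Mat
    M = Real.coefficientMatrix r s
  powers r s r≉2 (suc m) = begin
    A-h r s ⊗ (A-h r s ^ᴹ suc m)
      ≈⟨ ⊗-cong {B = A-h r s ^ᴹ suc m} (A-h-scaled r s) (powers r s r≉2 m) ⟩
    scale k M ⊗ scale k (Real.fibMatrix r s a b)
      ≈⟨ scaled-step {M = M} {N = Real.fibMatrix r s a b}
                     (inverse-r-2 r r≉2) (coefficient-step r s a b) ⟩
    scale k (Real.fibMatrix r s b (r * b + s * a)) ∎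
    where
    open ≈ᴹ-Reasoning
    k a b : Carrier
    k = (r - 2#) ⁻¹
    a = h r s m
    b = h r s (suc m)
    M : Mat
    M = Real.coefficientMatrix r s

mainTheorem3 : ∀ {c ℓ} (ℝ : RealNumbers c ℓ) → let open RealNumbers ℝ in
    (r s : Carrier) → ¬ (r ≈ 0#) → ¬ (r ≈ 2#) → ¬ (s ≈ 0#) →
    0# ≤ r * r + 4# * s →
    -- n = suc m ranges over all n ≥ 1; hShift r s k = h_{k-1}
    (m : ℕ) →
    (A-h r s ^ᴹ suc m) ≈ᴹ scale ((r - 2#) ⁻¹)
      (mat3 (h r s (suc (suc (suc m))) - h r s (suc (suc m)))
            (h r s (suc (suc m)) + s * h r s (suc m))
            (h r s (suc (suc (suc m))) + s * h r s (suc m))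
            (- (s * (h r s (suc m) - h r s m)))
            (- (s * (h r s m + s * hShift r s m)))
            (- (s * (h r s (suc m) + s * hShift r s m)))
            (- (h r s (suc (suc m)) - h r s (suc m)))
            (- (h r s (suc m) + s * h r s m))
            (- (h r s (suc (suc m)) + s * h r s m)))
mainTheorem3 ℝ r s _ r≉2 s≉0 _ m = begin
  A-h r s ^ᴹ suc m
    ≈⟨ powers r s r≉2 m ⟩
  scale k (Real.fibMatrix r s (h r s m) (h r s (suc m)))
    ≈⟨ scale-cong k (fibMatrix-h r s s≉0 m) ⟩
  scale k (hMatrix r s m) ∎
  where
  open RealNumbers ℝ
  open RealMatrices ℝ
  open ≈ᴹ-Reasoning
  k : Carrier
  k = (r - 2#) ⁻¹
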